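{- Let $\alpha$ be a non-degenerate $N$-simplex whose vertices are vertices of the simplotope $\Pi(c_1,\dots,c_n)$, $N=c_1+\cdots+c_n$, and let $\sigma,\tau$ be two exterior faces of $\alpha$. Then $\sigma\cap\tau$ is also an exterior face of $\alpha$.
   Context: $\Pi(c_1,\dots,c_n)=\Delta^{c_1}\times\cdots\times\Delta^{c_n}$, where $\Delta^d$ is the convex hull of the standard unit vectors of $\mathbb{R}^{d+1}$; vertices of the simplotope are the points whose standard coordinates are all $0$ or $1$. Non-degenerate means the $N+1$ vertices are affinely independent. An exterior $j$-face of $\alpha$ is a $j$-dimensional face of $\alpha$ whose $j+1$ vertices lie in a common $j$-dimensional face of the simplotope (equivalently, at least $N-j$ standard coordinates vanish at all of its vertices). -}

module Defs where

open import Data.Nat using (ℕ; zero; suc; _+_; _≤_)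
open import Data.Fin using (Fin; zero; suc) renaming (_≟_ to _≟F_)
open import Data.Fin.Subset using (Subset; _∈_; ∣_∣)
open import Data.Rational using (ℚ; 0ℚ; 1ℚ) renaming (_+_ to _+ℚ_; _*_ to _*ℚ_)
open import Data.Product using (Σ; _×_)
open import Relation.Binary.PropositionalEquality using (_≡_; _≢_)
open import Relation.Nullary using (yes; no)

sumℕ : ∀ {m} → (Fin m → ℕ) → ℕ
sumℕ {zero} f = 0
sumℕ {suc m} f = f zero + sumℕ (λ i → f (suc i))

sumℚ : ∀ {m} → (Fin m → ℚ) → ℚ
sumℚ {zero} f = 0ℚ
sumℚ {suc m} f = f zero +ℚ sumℚ (λ i → f (suc i))

-- Simplotope Π(c_1,…,c_n) ⊂ ℝ^{(c_1+1)+…+(c_n+1)}; standard coordinates are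
-- indexed by pairs (k , i) with k : Fin n and i : Fin (c_k + 1).
-- A vertex of the simplotope (all coordinates 0 or 1) picks exactly one unit
-- vector in each factor Δ^{c_k}, i.e. an element of Fin (c_k + 1) for each k.
Vertex : ∀ {n} → (Fin n → ℕ) → Set
Vertex {n} c = (k : Fin n) → Fin (suc (c k))

coord : ∀ {n} {c : Fin n → ℕ} → Vertex c → (k : Fin n) → Fin (suc (c k)) → ℚ
coord v k i with v k ≟F i
... | yes _ = 1ℚ
... | no _ = 0ℚ

dimΠ : ∀ {n} → (Fin n → ℕ) → ℕ
dimΠ c = sumℕ c

SimplexIn : ∀ {n} → (Fin n → ℕ) → Set
SimplexIn c = Fin (suc (dimΠ c)) → Vertex c

NonDegenerate : ∀ {n} (c : Fin n → ℕ) → SimplexIn c → Set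
NonDegenerate c α =
  (l : Fin (suc (dimΠ c)) → ℚ) →
  sumℚ l ≡ 0ℚ →
  (∀ k i → sumℚ (λ v → l v *ℚ coord (α v) k i) ≡ 0ℚ) →
  ∀ v → l v ≡ 0ℚ

-- a face of α is given by its vertex set F ⊆ {0,…,N}; it has dimension
-- j = ∣F∣ - 1.  It is exterior iff at least N - j standard coordinates vanish
-- at all of its vertices, i.e. there is a set Z of coordinates, all vanishing
-- on F, with ∣Z∣ ≥ N + 1 - ∣F∣.
Exterior : ∀ {n} (c : Fin n → ℕ) → SimplexIn c → Subset (suc (dimΠ c)) → Set
Exterior {n} c α F =
  Σ ((k : Fin n) → Subset (suc (c k))) λ Z →
    (∀ k i → i ∈ Z k → ∀ v → v ∈ F → α v k ≢ i) ×
    (suc (dimΠ c) ≤ sumℕ (λ k → ∣ Z k ∣) + ∣ F ∣)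

module Submission where

-- If a nonempty face F of α lies in the face of the simplotope
-- on which the coordinates Z vanish, a face of dimension N - ∣Z∣, then its
-- vertices are affinely independent points of an (N - ∣Z∣)-dimensional affine
-- space, so ∣F∣ + ∣Z∣ ≤ N + 1 (face-bound).  For exterior faces σ, τ with
-- coordinate witnesses Zσ, Zτ, the set Zσ ∪ Zτ vanishes on σ ∩ τ and Zσ ∩ Zτ
-- vanishes on σ ∪ τ.  Adding the exterior inequalities for σ and τ and
-- comparing with the face bound for σ ∪ τ, inclusion–exclusion for vertices
-- and for coordinates yields the exterior inequality for σ ∩ τ (modular-bound).

open import Defs
open import Data.Nat using (ℕ; suc)
open import Data.Fin using (Fin)
open import Data.Fin.Subset using (Subset; _∩_)

module RationalSums where
  open import Data.Nat using (zero; suc)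
  open import Data.Fin using (Fin; zero; suc)
  open import Data.Fin.Properties using (punchInᵢ≢i)
  open import Data.Rational using (ℚ; 0ℚ; _+_)
  open import Data.Rational.Properties using (+-*-commutativeRing; +-identityʳ)
  open import Data.Vec.Functional using (removeAt)
  open import Algebra.Bundles using (CommutativeRing)
  open import Relation.Binary.PropositionalEquality
  open import Algebra.Properties.Semiring.Sum (CommutativeRing.semiring +-*-commutativeRing)
    using (sum; sum-cong-≗; ∑-distrib-+; ∑-comm; *-distribˡ-sum) public
  open import Algebra.Properties.Semiring.Sum (CommutativeRing.semiring +-*-commutativeRing)
    using (sum-remove; sum-replicate-zero)

  sumℚ≡sum : ∀ {m} (f : Fin m → ℚ) → sumℚ f ≡ sum f
  sumℚ≡sum {zero} f = refl
  sumℚ≡sum {suc m} f = cong (f zero +_) (sumℚ≡sum (λ i → f (suc i)))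

  sum-zero : ∀ {m} (f : Fin m → ℚ) → (∀ i → f i ≡ 0ℚ) → sum f ≡ 0ℚ
  sum-zero {m} f f≡0 = trans (sum-cong-≗ f≡0) (sum-replicate-zero m)

  sum-single : ∀ {m} (f : Fin (suc m) → ℚ) i → (∀ j → j ≢ i → f j ≡ 0ℚ) → sum f ≡ f i
  sum-single f i off = begin
    sum f                    ≡⟨ sum-remove f ⟩
    f i + sum (removeAt f i) ≡⟨ cong (f i +_) (sum-zero _ (λ j → off _ (punchInᵢ≢i i j))) ⟩
    f i + 0ℚ                 ≡⟨ +-identityʳ (f i) ⟩
    f i                      ∎
    where open ≡-Reasoning

module LinearSystems where
  open RationalSums
  open import Data.Nat as ℕ using (ℕ; suc; _<_)
  open import Data.Nat.Properties using (≤-pred)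
  open import Data.Fin using (Fin; zero; suc)
  open import Data.Fin.Subset using (Subset; _∉_; ∣_∣; inside; outside)
  open import Data.Vec using ([]; _∷_; here; there)
  open import Data.Vec.Functional using (tail)
  open import Data.Rational using (ℚ; 0ℚ; 1ℚ; _+_; _*_; -_; 1/_; ≢-nonZero)
  open import Data.Rational.Properties as ℚP
    using (*-zeroʳ; *-identityˡ; *-identityʳ; *-assoc; *-inverseˡ; +-identityˡ)
  open import Data.Rational.Solver using (module +-*-Solver)
  open import Data.List using (List; []; _∷_; length; map)
  open import Data.List.Properties using (length-map)
  open import Data.List.Relation.Unary.All using (All; []; _∷_)
  import Data.List.Relation.Unary.All as All
  open import Data.List.Relation.Unary.All.Properties using (map⁻)
  open import Data.List.Relation.Binary.Permutation.Propositional
    using (_↭_; ↭-refl; ↭-trans; ↭-sym; prep; swap)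
  open import Data.List.Relation.Binary.Permutation.Propositional.Properties
    using (All-resp-↭; ↭-length)
  open import Data.Product using (Σ; _×_; _,_; proj₁; proj₂)
  open import Data.Sum using (_⊎_; inj₁; inj₂)
  open import Relation.Nullary using (yes; no)
  open import Data.Empty using (⊥-elim)
  open import Relation.Binary.PropositionalEquality
  open ≡-Reasoning

  Form : ℕ → Set
  Form p = Fin p → ℚ

  infix 7 _·_
  _·_ : ∀ {p} → Form p → (Fin p → ℚ) → ℚ
  a · x = sum (λ i → a i * x i)

  record Solution {p} (G : Subset p) (E : List (Form p)) : Set where
    field
      vec     : Fin p → ℚ
      nonzero : Σ (Fin p) λ i → vec i ≢ 0ℚ
      support : ∀ i → i ∉ G → vec i ≡ 0ℚ
      solves  : All (λ a → a · vec ≡ 0ℚ) E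

  *-nonzero : ∀ {r s} → r ≢ 0ℚ → s ≢ 0ℚ → r * s ≢ 0ℚ
  *-nonzero {r} {s} r≢0 s≢0 rs≡0 = s≢0 (begin
    s                  ≡⟨ sym (*-identityˡ s) ⟩
    1ℚ * s             ≡⟨ cong (_* s) (sym (*-inverseˡ r)) ⟩
    1/ r * r * s       ≡⟨ *-assoc (1/ r) r s ⟩
    1/ r * (r * s)     ≡⟨ cong (1/ r *_) rs≡0 ⟩
    1/ r * 0ℚ          ≡⟨ *-zeroʳ (1/ r) ⟩
    0ℚ                 ∎)
    where instance _ = ≢-nonZero r≢0

  ·-scale : ∀ {p} (a : Form p) r y → a · (λ i → r * y i) ≡ r * (a · y)
  ·-scale a r y = trans (sum-cong-≗ (λ i → commute (a i) (y i))) (sym (*-distribˡ-sum r (λ i → a i * y i)))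
    where
    open +-*-Solver
    commute : ∀ u v → u * (r * v) ≡ r * (u * v)
    commute = solve 3 (λ r u v → u :* (r :* v) := r :* (u :* v)) refl r

  ·-combination : ∀ {p} r s (a b : Form p) y → (λ i → r * a i + s * b i) · y ≡ r * (a · y) + s * (b · y)
  ·-combination r s a b y = begin
    sum (λ i → (r * a i + s * b i) * y i)           ≡⟨ sum-cong-≗ (λ i → distribute (a i) (b i) (y i)) ⟩
    sum (λ i → r * (a i * y i) + s * (b i * y i))   ≡⟨ ∑-distrib-+ (λ i → r * (a i * y i)) (λ i → s * (b i * y i)) ⟩
    sum (λ i → r * (a i * y i)) + sum (λ i → s * (b i * y i))
      ≡⟨ sym (cong₂ _+_ (*-distribˡ-sum r (λ i → a i * y i)) (*-distribˡ-sum s (λ i → b i * y i))) ⟩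
    r * (a · y) + s * (b · y)                       ∎
    where
    open +-*-Solver
    distribute : ∀ u v w → (r * u + s * v) * w ≡ r * (u * w) + s * (v * w)
    distribute = solve 5 (λ r s u v w → (r :* u :+ s :* v) :* w := r :* (u :* w) :+ s :* (v :* w)) refl r s

  Pivot : ∀ {p} → List (Form (suc p)) → Set
  Pivot {p} E = Σ (Form (suc p)) λ a → a zero ≢ 0ℚ × Σ (List (Form (suc p))) λ R → E ↭ a ∷ R

  pivot : ∀ {p} (E : List (Form (suc p))) → All (λ a → a zero ≡ 0ℚ) E ⊎ Pivot E
  pivot [] = inj₁ []
  pivot (b ∷ E) with b zero ℚP.≟ 0ℚ | pivot E
  ... | no b₀≢0  | _    = inj₂ (b , b₀≢0 , E , ↭-refl)
  ... | yes b₀≡0 | inj₁ free = inj₁ (b₀≡0 ∷ free)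
  ... | yes _    | inj₂ (a , a₀≢0 , R , E↭a∷R) =
    inj₂ (a , a₀≢0 , b ∷ R , ↭-trans (prep b E↭a∷R) (swap b a ↭-refl))

  eliminate : ∀ {p} → Form (suc p) → Form (suc p) → Form p
  eliminate a b i = a zero * b (suc i) + (- b zero) * a (suc i)

  extend : ∀ {p} → Form (suc p) → (Fin p → ℚ) → Fin (suc p) → ℚ
  extend a y zero    = - (tail a · y)
  extend a y (suc i) = a zero * y i

  extend-pivot : ∀ {p} (a : Form (suc p)) y → a · extend a y ≡ 0ℚ
  extend-pivot a y = begin
    a zero * (- (tail a · y)) + tail a · (λ i → a zero * y i)
      ≡⟨ cong (a zero * (- (tail a · y)) +_) (·-scale (tail a) (a zero) y) ⟩
    a zero * (- (tail a · y)) + a zero * (tail a · y)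
      ≡⟨ cancel (a zero) (tail a · y) ⟩
    0ℚ ∎
    where
    open +-*-Solver
    cancel : ∀ u d → u * (- d) + u * d ≡ 0ℚ
    cancel = solve 2 (λ u d → u :* (:- d) :+ u :* d := con 0ℚ) refl

  extend-other : ∀ {p} (a b : Form (suc p)) y → eliminate a b · y ≡ 0ℚ → b · extend a y ≡ 0ℚ
  extend-other a b y reduced = begin
    b zero * (- (tail a · y)) + tail b · (λ i → a zero * y i)
      ≡⟨ cong (b zero * (- (tail a · y)) +_) (·-scale (tail b) (a zero) y) ⟩
    b zero * (- (tail a · y)) + a zero * (tail b · y)
      ≡⟨ rearrange (b zero) (a zero) (tail a · y) (tail b · y) ⟩
    a zero * (tail b · y) + (- b zero) * (tail a · y)
      ≡⟨ sym (·-combination (a zero) (- b zero) (tail b) (tail a) y) ⟩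
    eliminate a b · y
      ≡⟨ reduced ⟩
    0ℚ ∎
    where
    open +-*-Solver
    rearrange : ∀ u v d e → u * (- d) + v * e ≡ v * e + (- u) * d
    rearrange = solve 4 (λ u v d e → u :* (:- d) :+ v :* e := v :* e :+ (:- u) :* d) refl

  solution-fixed : ∀ {p} (G : Subset p) (E : List (Form (suc p))) →
                   Solution G (map tail E) → Solution (outside ∷ G) E
  solution-fixed G E s = record
    { vec     = x
    ; nonzero = suc (proj₁ nonzero) , proj₂ nonzero
    ; support = λ { zero _ → refl ; (suc j) j∉G → support j (λ j∈G → j∉G (there j∈G)) }
    ; solves  = All.map (λ {a} eq → trans (cong (_+ tail a · y) (*-zeroʳ (a zero))) (trans (+-identityˡ _) eq)) (map⁻ solves)
    }
    where
    open Solution s renaming (vec to y)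
    x : Fin (suc _) → ℚ
    x zero    = 0ℚ
    x (suc j) = y j

  solution-free : ∀ {p} (G : Subset p) (E : List (Form (suc p))) →
                  All (λ a → a zero ≡ 0ℚ) E → Solution (inside ∷ G) E
  solution-free {p} G E free = record
    { vec     = x
    ; nonzero = zero , ℚP.1≢0
    ; support = λ { zero 0∉G → ⊥-elim (0∉G here) ; (suc j) _ → refl }
    ; solves  = All.map (λ {b} → vanishes {b}) free
    }
    where
    x : Fin (suc p) → ℚ
    x zero    = 1ℚ
    x (suc j) = 0ℚ
    vanishes : ∀ {a : Form (suc p)} → a zero ≡ 0ℚ → a · x ≡ 0ℚ
    vanishes {a} a₀≡0 = begin
      a zero * 1ℚ + tail a · (λ _ → 0ℚ) ≡⟨ cong₂ _+_ (trans (*-identityʳ (a zero)) a₀≡0) (sum-zero _ (λ i → *-zeroʳ (a (suc i)))) ⟩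
      0ℚ + 0ℚ                           ≡⟨ +-identityˡ 0ℚ ⟩
      0ℚ                                ∎

  solution-pivot : ∀ {p} (G : Subset p) (E : List (Form (suc p))) ((a , _ , R , _) : Pivot E) →
                   Solution G (map (eliminate a) R) → Solution (inside ∷ G) E
  solution-pivot G E (a , a₀≢0 , R , E↭a∷R) s = record
    { vec     = extend a y
    ; nonzero = suc (proj₁ nonzero) , *-nonzero a₀≢0 (proj₂ nonzero)
    ; support = λ { zero 0∉G → ⊥-elim (0∉G here)
                  ; (suc j) j∉G → trans (cong (a zero *_) (support j (λ j∈G → j∉G (there j∈G)))) (*-zeroʳ (a zero)) }
    ; solves  = All-resp-↭ (↭-sym E↭a∷R) (extend-pivot a y ∷ All.map (λ {b} → extend-other a b y) (map⁻ solves))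
    }
    where open Solution s renaming (vec to y)

  underdetermined : ∀ {p} (G : Subset p) (E : List (Form p)) → length E < ∣ G ∣ → Solution G E
  underdetermined [] E ()
  underdetermined (outside ∷ G) E short =
    solution-fixed G E (underdetermined G (map tail E) (subst (_< ∣ G ∣) (sym (length-map tail E)) short))
  underdetermined (inside ∷ G) E short with pivot E
  ... | inj₁ free = solution-free G E free
  ... | inj₂ piv@(a , _ , R , E↭a∷R) =
    solution-pivot G E piv (underdetermined G (map (eliminate a) R) shorter)
    where
    shorter : length (map (eliminate a) R) < ∣ G ∣
    shorter = subst (_< ∣ G ∣) (sym (length-map (eliminate a) R)) (subst (ℕ._≤ ∣ G ∣) (↭-length E↭a∷R) (≤-pred short))

module Counting where
  open import Data.Nat using (ℕ; zero; suc; _+_; _∸_; _≤_; _<_; z≤n)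
  open import Data.Nat.Properties
    using (+-suc; +-mono-≤; +-monoˡ-≤; +-monoˡ-<; +-cancelˡ-≤; m∸n+n≡m; +-commutativeSemigroup; module ≤-Reasoning)
  open import Data.Nat.Solver using (module +-*-Solver)
  open import Algebra.Properties.CommutativeSemigroup +-commutativeSemigroup
    using () renaming (interchange to +-interchange)
  open import Data.Fin using (Fin; zero; suc)
  open import Data.Fin.Subset using (Subset; _∈_; _∉_; ∣_∣; ∁; _∩_; _∪_; _-_; inside; outside)
  open import Data.Fin.Subset.Properties using (x∈p⇒∣p-x∣<∣p∣; ∣∁p∣≡n∸∣p∣; ∣p∣≤n; x∉p⇒x∈∁p)
  open import Data.Vec using ([]; _∷_; here; there)
  open import Data.List using (List; []; _∷_; length; _++_)
  open import Data.List.Properties using (length-++)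
  open import Data.List.Relation.Unary.All using (All; _∷_)
  open import Data.List.Relation.Unary.All.Properties using (++⁻ˡ; ++⁻ʳ)
  open import Relation.Binary.PropositionalEquality
  open ≤-Reasoning

  sumℕ-+ : ∀ {n} (f g : Fin n → ℕ) → sumℕ (λ k → f k + g k) ≡ sumℕ f + sumℕ g
  sumℕ-+ {zero} f g = refl
  sumℕ-+ {suc n} f g =
    trans (cong ((f zero + g zero) +_) (sumℕ-+ (λ k → f (suc k)) (λ k → g (suc k))))
          (+-interchange (f zero) (g zero) (sumℕ (λ k → f (suc k))) (sumℕ (λ k → g (suc k))))

  sumℕ-cong : ∀ {n} {f g : Fin n → ℕ} → (∀ k → f k ≡ g k) → sumℕ f ≡ sumℕ g
  sumℕ-cong {zero} f≡g = refl
  sumℕ-cong {suc n} f≡g = cong₂ _+_ (f≡g zero) (sumℕ-cong (λ k → f≡g (suc k)))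

  sumℕ-mono : ∀ {n} {f g : Fin n → ℕ} → (∀ k → f k ≤ g k) → sumℕ f ≤ sumℕ g
  sumℕ-mono {zero} f≤g = z≤n
  sumℕ-mono {suc n} f≤g = +-mono-≤ (f≤g zero) (sumℕ-mono (λ k → f≤g (suc k)))

  ∣p∩q∣+∣p∪q∣ : ∀ {m} (p q : Subset m) → ∣ p ∩ q ∣ + ∣ p ∪ q ∣ ≡ ∣ p ∣ + ∣ q ∣
  ∣p∩q∣+∣p∪q∣ [] [] = refl
  ∣p∩q∣+∣p∪q∣ (inside ∷ p) (inside ∷ q) =
    cong suc (trans (+-suc _ _) (trans (cong suc (∣p∩q∣+∣p∪q∣ p q)) (sym (+-suc _ _))))
  ∣p∩q∣+∣p∪q∣ (inside ∷ p) (outside ∷ q) = trans (+-suc _ _) (cong suc (∣p∩q∣+∣p∪q∣ p q))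
  ∣p∩q∣+∣p∪q∣ (outside ∷ p) (inside ∷ q) =
    trans (+-suc _ _) (trans (cong suc (∣p∩q∣+∣p∪q∣ p q)) (sym (+-suc _ _)))
  ∣p∩q∣+∣p∪q∣ (outside ∷ p) (outside ∷ q) = ∣p∩q∣+∣p∪q∣ p q

  ∣∁p-x∣+∣p∣<m : ∀ {m} (p : Subset m) {x} → x ∉ p → ∣ ∁ p - x ∣ + ∣ p ∣ < m
  ∣∁p-x∣+∣p∣<m {m} p x∉p = begin-strict
    ∣ ∁ p - _ ∣ + ∣ p ∣ <⟨ +-monoˡ-< ∣ p ∣ (x∈p⇒∣p-x∣<∣p∣ (x∉p⇒x∈∁p x∉p)) ⟩
    ∣ ∁ p ∣ + ∣ p ∣      ≡⟨ cong (_+ ∣ p ∣) (∣∁p∣≡n∸∣p∣ p) ⟩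
    (m ∸ ∣ p ∣) + ∣ p ∣  ≡⟨ m∸n+n≡m (∣p∣≤n p) ⟩
    m                    ∎

  -- The counting at the heart of the theorem: the exterior inequalities for
  -- σ and τ, modularity of the vertex and coordinate counts, and the face
  -- bound for σ ∪ τ give the exterior inequality for σ ∩ τ.
  modular-bound : ∀ {s zσ gσ zτ gτ z∩ z∪ g∩ g∪} →
    s ≤ zσ + gσ → s ≤ zτ + gτ → z∩ + z∪ ≡ zσ + zτ → g∩ + g∪ ≡ gσ + gτ →
    g∪ + z∩ ≤ s → s ≤ z∪ + g∩
  modular-bound {s} {zσ} {gσ} {zτ} {gτ} {z∩} {z∪} {g∩} {g∪} σ-bound τ-bound z-modular g-modular ∪-bound =
    +-cancelˡ-≤ s _ _ (begin
      s + s                  ≤⟨ +-mono-≤ σ-bound τ-bound ⟩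
      (zσ + gσ) + (zτ + gτ)  ≡⟨ +-interchange zσ gσ zτ gτ ⟩
      (zσ + zτ) + (gσ + gτ)  ≡⟨ cong₂ _+_ z-modular g-modular ⟨
      (z∩ + z∪) + (g∩ + g∪)  ≡⟨ rearrange z∩ z∪ g∩ g∪ ⟩
      (g∪ + z∩) + (z∪ + g∩)  ≤⟨ +-monoˡ-≤ (z∪ + g∩) ∪-bound ⟩
      s + (z∪ + g∩)          ∎)
    where
    open +-*-Solver
    rearrange : ∀ a b c d → (a + b) + (c + d) ≡ (d + a) + (b + c)
    rearrange = solve 4 (λ a b c d → (a :+ b) :+ (c :+ d) := (d :+ a) :+ (b :+ c)) refl

  rows : ∀ {m} {A : Set} → Subset m → (Fin m → A) → List A
  rows []            f = []
  rows (inside ∷ W)  f = f zero ∷ rows W (λ i → f (suc i))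
  rows (outside ∷ W) f = rows W (λ i → f (suc i))

  length-rows : ∀ {m} {A : Set} (W : Subset m) (f : Fin m → A) → length (rows W f) ≡ ∣ W ∣
  length-rows []            f = refl
  length-rows (inside ∷ W)  f = cong suc (length-rows W (λ i → f (suc i)))
  length-rows (outside ∷ W) f = length-rows W (λ i → f (suc i))

  rows-All : ∀ {m} {A : Set} {P : A → Set} (W : Subset m) (f : Fin m → A) →
             All P (rows W f) → ∀ i → i ∈ W → P (f i)
  rows-All (inside ∷ W)  f (p ∷ ps) zero    here        = p
  rows-All (inside ∷ W)  f (p ∷ ps) (suc i) (there i∈W) = rows-All W (λ i → f (suc i)) ps i i∈W
  rows-All (outside ∷ W) f ps       (suc i) (there i∈W) = rows-All W (λ i → f (suc i)) ps i i∈W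

  rowsᶠ : ∀ {n} {m : Fin n → ℕ} {A : Set} → ((k : Fin n) → Subset (m k)) → ((k : Fin n) → Fin (m k) → A) → List A
  rowsᶠ {zero}  W f = []
  rowsᶠ {suc n} W f = rows (W zero) (f zero) ++ rowsᶠ (λ k → W (suc k)) (λ k → f (suc k))

  length-rowsᶠ : ∀ {n} {m : Fin n → ℕ} {A : Set} (W : (k : Fin n) → Subset (m k)) (f : (k : Fin n) → Fin (m k) → A) →
                 length (rowsᶠ W f) ≡ sumℕ (λ k → ∣ W k ∣)
  length-rowsᶠ {zero}  W f = refl
  length-rowsᶠ {suc n} W f = trans (length-++ (rows (W zero) (f zero)))
    (cong₂ _+_ (length-rows (W zero) (f zero)) (length-rowsᶠ (λ k → W (suc k)) (λ k → f (suc k))))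

  rowsᶠ-All : ∀ {n} {m : Fin n → ℕ} {A : Set} {P : A → Set} (W : (k : Fin n) → Subset (m k)) (f : (k : Fin n) → Fin (m k) → A) →
              All P (rowsᶠ W f) → ∀ k i → i ∈ W k → P (f k i)
  rowsᶠ-All {suc n} W f ps zero    = rows-All (W zero) (f zero) (++⁻ˡ (rows (W zero) (f zero)) ps)
  rowsᶠ-All {suc n} W f ps (suc k) = rowsᶠ-All (λ k → W (suc k)) (λ k → f (suc k)) (++⁻ʳ (rows (W zero) (f zero)) ps) k

module Simplotope {n} (c : Fin n → ℕ) where
  open RationalSums
  open LinearSystems using (Form; _·_; Solution; underdetermined)
  open Counting
  open import Data.Nat using (ℕ; suc; _+_; _≤_; _<_; _≤?_; s≤s)
  open import Data.Nat.Properties using (≤-pred; ≰⇒>; ≤-trans; +-cancelʳ-≤)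
  open import Data.Fin using (Fin) renaming (_≟_ to _≟F_)
  open import Data.Fin.Subset using (Subset; _∈_; _∉_; ∣_∣; ∁; _-_; _∩_; _∪_)
  open import Data.Fin.Subset.Properties
    using (_∈?_; x∉p⇒x∈∁p; x∈p∧x≢y⇒x∈p-y; x∈p∪q⁻; x∈p∩q⁻; p⊆q⇒∣p∣≤∣q∣; p⊆p∪q)
  open import Data.Rational using (ℚ; 0ℚ; 1ℚ; _*_)
  open import Data.Rational.Properties using (*-zeroˡ; *-zeroʳ; *-identityˡ; *-identityʳ; *-comm)
  open import Data.List using (List; _∷_; length)
  import Data.List.Relation.Unary.All as All
  open import Data.Product using (proj₁; proj₂)
  open import Data.Sum using (inj₁; inj₂)
  open import Data.Empty using (⊥-elim)
  open import Relation.Nullary using (yes; no)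
  open import Relation.Binary.PropositionalEquality
  open ≡-Reasoning

  Coords : Set
  Coords = (k : Fin n) → Subset (suc (c k))

  total : Coords → ℕ
  total Z = sumℕ (λ k → ∣ Z k ∣)

  Vanishes : ∀ {m} → (Fin m → Vertex c) → Coords → Subset m → Set
  Vanishes α Z F = ∀ k i → i ∈ Z k → ∀ v → v ∈ F → α v k ≢ i

  coord-off : (w : Vertex c) → ∀ k i → w k ≢ i → coord w k i ≡ 0ℚ
  coord-off w k i w≢i with w k ≟F i
  ... | yes w≡i = ⊥-elim (w≢i w≡i)
  ... | no _    = refl

  coord-on : (w : Vertex c) → ∀ k → coord w k (w k) ≡ 1ℚ
  coord-on w k with w k ≟F w k
  ... | yes _   = refl
  ... | no w≢w  = ⊥-elim (w≢w refl)

  coord-block-sum : (w : Vertex c) → ∀ k → sum (coord w k) ≡ 1ℚ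
  coord-block-sum w k = trans (sum-single (coord w k) (w k) (λ i i≢w → coord-off w k i (λ w≡i → i≢w (sym w≡i))))
                              (coord-on w k)

  weight : ∀ {m} → (Fin m → Vertex c) → (Fin m → ℚ) → (k : Fin n) → Fin (suc (c k)) → ℚ
  weight α x k i = sum (λ v → x v * coord (α v) k i)

  weight-block-sum : ∀ {m} (α : Fin m → Vertex c) x k → sum (weight α x k) ≡ sum x
  weight-block-sum α x k = begin
    sum (λ i → sum (λ v → x v * coord (α v) k i)) ≡⟨ ∑-comm (λ i v → x v * coord (α v) k i) ⟩
    sum (λ v → sum (λ i → x v * coord (α v) k i)) ≡⟨ sum-cong-≗ (λ v → sym (*-distribˡ-sum (x v) (coord (α v) k))) ⟩
    sum (λ v → x v * sum (coord (α v) k))         ≡⟨ sum-cong-≗ (λ v → trans (cong (x v *_) (coord-block-sum (α v) k)) (*-identityʳ (x v))) ⟩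
    sum x                                         ∎

  weight-vanishing : ∀ {m} (α : Fin m → Vertex c) x Z F → Vanishes α Z F → (∀ v → v ∉ F → x v ≡ 0ℚ) →
                     ∀ k i → i ∈ Z k → weight α x k i ≡ 0ℚ
  weight-vanishing α x Z F van support k i i∈Z = sum-zero _ term
    where
    term : ∀ v → x v * coord (α v) k i ≡ 0ℚ
    term v with v ∈? F
    ... | yes v∈F = trans (cong (x v *_) (coord-off (α v) k i (van k i i∈Z v v∈F))) (*-zeroʳ (x v))
    ... | no v∉F  = trans (cong (_* coord (α v) k i) (support v v∉F)) (*-zeroˡ (coord (α v) k i))

  free-coords : ∀ {m} → (Fin m → Vertex c) → Coords → Fin m → Coords
  free-coords α Z v₀ k = ∁ (Z k) - α v₀ k

  weight-off-vertex : ∀ {m} (α : Fin m → Vertex c) x Z F v₀ → Vanishes α Z F →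
                      (∀ v → v ∉ F → x v ≡ 0ℚ) →
                      (∀ k i → i ∈ free-coords α Z v₀ k → weight α x k i ≡ 0ℚ) →
                      ∀ k i → i ≢ α v₀ k → weight α x k i ≡ 0ℚ
  weight-off-vertex α x Z F v₀ van support free-zero k i i≢v₀ with i ∈? Z k
  ... | yes i∈Z = weight-vanishing α x Z F van support k i i∈Z
  ... | no i∉Z  = free-zero k i (x∈p∧x≢y⇒x∈p-y (x∉p⇒x∈∁p i∉Z) i≢v₀)

  -- If moreover the total weight is 0, all weights vanish: the remaining
  -- coordinate of each block is determined by the block sum.
  affine-dependence : ∀ {m} (α : Fin m → Vertex c) x Z F v₀ → Vanishes α Z F →
                      (∀ v → v ∉ F → x v ≡ 0ℚ) → sum x ≡ 0ℚ →
                      (∀ k i → i ∈ free-coords α Z v₀ k → weight α x k i ≡ 0ℚ) →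
                      ∀ k i → weight α x k i ≡ 0ℚ
  affine-dependence α x Z F v₀ van support total-zero free-zero k i with i ≟F α v₀ k
  ... | no i≢v₀  = weight-off-vertex α x Z F v₀ van support free-zero k i i≢v₀
  ... | yes refl = begin
    weight α x k (α v₀ k) ≡⟨ sum-single (weight α x k) (α v₀ k) (weight-off-vertex α x Z F v₀ van support free-zero k) ⟨
    sum (weight α x k)    ≡⟨ weight-block-sum α x k ⟩
    sum x                 ≡⟨ total-zero ⟩
    0ℚ                    ∎

  -- Otherwise
  -- the system "total weight 0, weight 0 on every free coordinate" has fewer
  -- equations than vertices of F, so it has a nonzero solution supported on F,
  -- which is a nontrivial affine dependence of the vertices of α.
  face-bound : (α : SimplexIn c) → NonDegenerate c α →
               (F : Subset (suc (dimΠ c))) (v₀ : Fin (suc (dimΠ c))) → v₀ ∈ F →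
               (Z : Coords) → Vanishes α Z F → ∣ F ∣ + total Z ≤ suc (dimΠ c)
  face-bound α nd F v₀ v₀∈F Z van with ∣ F ∣ + total Z ≤? suc (dimΠ c)
  ... | yes bound = bound
  ... | no excess = ⊥-elim (proj₂ nonzero (trivial (proj₁ nonzero)))
    where
    W : Coords
    W = free-coords α Z v₀

    coord-form : (k : Fin n) → Fin (suc (c k)) → Form (suc (dimΠ c))
    coord-form k i v = coord (α v) k i

    E : List (Form (suc (dimΠ c)))
    E = (λ _ → 1ℚ) ∷ rowsᶠ W coord-form

    free-count : sumℕ (λ k → ∣ W k ∣) + total Z ≤ dimΠ c
    free-count = subst (_≤ dimΠ c) (sumℕ-+ (λ k → ∣ W k ∣) (λ k → ∣ Z k ∣))
      (sumℕ-mono (λ k → ≤-pred (∣∁p-x∣+∣p∣<m (Z k) (λ v₀∈Z → van k _ v₀∈Z v₀ v₀∈F refl))))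

    few : length E < ∣ F ∣
    few = subst (λ ℓ → suc ℓ < ∣ F ∣) (sym (length-rowsᶠ W coord-form))
      (+-cancelʳ-≤ (total Z) _ _ (≤-trans (s≤s (s≤s free-count)) (≰⇒> excess)))

    open Solution (underdetermined F E few)

    total-zero : sum vec ≡ 0ℚ
    total-zero = trans (sum-cong-≗ (λ v → sym (*-identityˡ (vec v)))) (All.head solves)

    free-zero : ∀ k i → i ∈ W k → weight α vec k i ≡ 0ℚ
    free-zero k i i∈W = trans (sum-cong-≗ (λ v → *-comm (vec v) (coord (α v) k i)))
                              (rowsᶠ-All W coord-form (All.tail solves) k i i∈W)

    dependence : ∀ k i → weight α vec k i ≡ 0ℚ
    dependence = affine-dependence α vec Z F v₀ van support total-zero free-zero

    trivial : ∀ v → vec v ≡ 0ℚ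
    trivial = nd vec (trans (sumℚ≡sum vec) total-zero)
                (λ k i → trans (sumℚ≡sum (λ v → vec v * coord (α v) k i)) (dependence k i))

  vanishes-∪-∩ : ∀ {m} (α : Fin m → Vertex c) Zσ Zτ σ τ → Vanishes α Zσ σ → Vanishes α Zτ τ →
                 Vanishes α (λ k → Zσ k ∪ Zτ k) (σ ∩ τ)
  vanishes-∪-∩ α Zσ Zτ σ τ vanσ vanτ k i i∈Z v v∈σ∩τ with x∈p∪q⁻ (Zσ k) (Zτ k) i∈Z
  ... | inj₁ i∈Zσ = vanσ k i i∈Zσ v (proj₁ (x∈p∩q⁻ σ τ v∈σ∩τ))
  ... | inj₂ i∈Zτ = vanτ k i i∈Zτ v (proj₂ (x∈p∩q⁻ σ τ v∈σ∩τ))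

  vanishes-∩-∪ : ∀ {m} (α : Fin m → Vertex c) Zσ Zτ σ τ → Vanishes α Zσ σ → Vanishes α Zτ τ →
                 Vanishes α (λ k → Zσ k ∩ Zτ k) (σ ∪ τ)
  vanishes-∩-∪ α Zσ Zτ σ τ vanσ vanτ k i i∈Z v v∈σ∪τ with x∈p∪q⁻ σ τ v∈σ∪τ
  ... | inj₁ v∈σ = vanσ k i (proj₁ (x∈p∩q⁻ (Zσ k) (Zτ k) i∈Z)) v v∈σ
  ... | inj₂ v∈τ = vanτ k i (proj₂ (x∈p∩q⁻ (Zσ k) (Zτ k) i∈Z)) v v∈τ

  total-∩-∪ : (Zσ Zτ : Coords) → total (λ k → Zσ k ∩ Zτ k) + total (λ k → Zσ k ∪ Zτ k) ≡ total Zσ + total Zτ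
  total-∩-∪ Zσ Zτ = begin
    total (λ k → Zσ k ∩ Zτ k) + total (λ k → Zσ k ∪ Zτ k)   ≡⟨ sumℕ-+ (λ k → ∣ Zσ k ∩ Zτ k ∣) (λ k → ∣ Zσ k ∪ Zτ k ∣) ⟨
    sumℕ (λ k → ∣ Zσ k ∩ Zτ k ∣ + ∣ Zσ k ∪ Zτ k ∣)         ≡⟨ sumℕ-cong (λ k → ∣p∩q∣+∣p∪q∣ (Zσ k) (Zτ k)) ⟩
    sumℕ (λ k → ∣ Zσ k ∣ + ∣ Zτ k ∣)                       ≡⟨ sumℕ-+ (λ k → ∣ Zσ k ∣) (λ k → ∣ Zτ k ∣) ⟩
    total Zσ + total Zτ                                    ∎

  total-⊆-∪ : (Zσ Zτ : Coords) → total Zσ ≤ total (λ k → Zσ k ∪ Zτ k)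
  total-⊆-∪ Zσ Zτ = sumℕ-mono (λ k → p⊆q⇒∣p∣≤∣q∣ (p⊆p∪q {p = Zσ k} (Zτ k)))

open import Data.Nat using (_+_; _≤_)
open import Data.Nat.Properties using (≤-trans; +-mono-≤)
open import Data.Fin.Subset using (_∪_; ∣_∣)
open import Data.Fin.Subset.Properties using (nonempty?; x∈p∪q⁺; p⊆q⇒∣p∣≤∣q∣)
open import Data.Product using (_,_)
open import Data.Sum using (inj₁)
open import Data.Empty using (⊥-elim)
open import Relation.Nullary using (yes; no)
open Counting using (modular-bound; ∣p∩q∣+∣p∪q∣)

-- The required count follows from
-- the bound for σ alone when σ is empty (then ∣ σ ∣ ≤ ∣ σ ∩ τ ∣), and otherwise
-- from the bounds for σ and τ and the face bound for σ ∪ τ with witness Zσ ∩ Zτ.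
proposition15 : (n : ℕ) (c : Fin n → ℕ) (α : SimplexIn c) →
    NonDegenerate c α →
    (σ τ : Subset (suc (dimΠ c))) →
    Exterior c α σ → Exterior c α τ → Exterior c α (σ ∩ τ)
proposition15 n c α nd σ τ (Zσ , vanσ , σ-bound) (Zτ , vanτ , τ-bound) =
  Z∪ , vanishes-∪-∩ α Zσ Zτ σ τ vanσ vanτ , bound
  where
  open Simplotope c
  Z∪ Z∩ : Coords
  Z∪ k = Zσ k ∪ Zτ k
  Z∩ k = Zσ k ∩ Zτ k

  bound : suc (dimΠ c) ≤ total Z∪ + ∣ σ ∩ τ ∣
  bound with nonempty? σ
  ... | yes (v₀ , v₀∈σ) =
    modular-bound {zσ = total Zσ} {∣ σ ∣} {total Zτ} {∣ τ ∣} {total Z∩} {total Z∪} {∣ σ ∩ τ ∣} {∣ σ ∪ τ ∣}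
      σ-bound τ-bound (total-∩-∪ Zσ Zτ) (∣p∩q∣+∣p∪q∣ σ τ)
      (face-bound α nd (σ ∪ τ) v₀ (x∈p∪q⁺ (inj₁ v₀∈σ)) Z∩ (vanishes-∩-∪ α Zσ Zτ σ τ vanσ vanτ))
  ... | no σ-empty =
    ≤-trans σ-bound (+-mono-≤ (total-⊆-∪ Zσ Zτ) (p⊆q⇒∣p∣≤∣q∣ {q = σ ∩ τ} (λ v∈σ → ⊥-elim (σ-empty (_ , v∈σ)))))
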